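{- Let $G$ be a matroid on $[n]$ with no loops and no multiple points. Then $G$ is line-closed if and only if, for every linear ordering of $[n]$, the set of nbb sets of $G$ coincides with the set of nbc sets of $G$ (both computed with respect to that ordering).
   Context: $\operatorname{cl}$ denotes matroid closure. A subset $S\subseteq[n]$ is line-closed if $\operatorname{cl}(\{i,j\})\subseteq S$ for all $i,j\in S$; $G$ is line-closed if every line-closed set is closed (i.e. equals its closure). The line-closure $\operatorname{lc}(S)$ is the intersection of all line-closed sets containing $S$. Given a linear order on $[n]$: a broken circuit is $C-\min(C)$ for a circuit $C$; an nbc set is a subset containing no broken circuit; a subset $S=\{i_1<\dots<i_p\}$ (increasing in the given order) is nbb if $i_k=\min\operatorname{lc}(\{i_k,\dots,i_p\})$ for each $1\le k\le p$, minima taken in the given order. -}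

module Defs where

open import Data.Nat using (ℕ; _<_)
open import Data.Fin using (Fin; toℕ)
import Data.Fin as F
open import Data.Fin.Subset using (Subset; _∈_; _∉_; _⊆_; _⊂_; _∪_; _-_; ⁅_⁆; ∣_∣) renaming (⊥ to ∅)
open import Data.Fin.Permutation using (Permutation′; _⟨$⟩ʳ_)
open import Data.Product using (Σ; ∃; _×_)
open import Relation.Nullary using (¬_; Dec)
open import Relation.Binary.PropositionalEquality using (_≡_; _≢_)

-- Independence is decidable (every predicate on a finite set is,
-- classically; this is the constructive rendering of "given data").
record Matroid (n : ℕ) : Set₁ where
  field
    Indep     : Subset n → Set
    Indep-dec : (I : Subset n) → Dec (Indep I)
    indep-∅   : Indep ∅
    indep-⊆   : ∀ {I J} → I ⊆ J → Indep J → Indep I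
    exchange  : ∀ {I J} → Indep I → Indep J → ∣ I ∣ < ∣ J ∣ →
                ∃ λ x → x ∈ J × x ∉ I × Indep (I ∪ ⁅ x ⁆)

module _ {n : ℕ} (G : Matroid n) where
  open Matroid G

  Circuit : Subset n → Set
  Circuit C = ¬ Indep C × (∀ D → D ⊂ C → Indep D)

  NoLoops : Set
  NoLoops = ∀ x → Indep ⁅ x ⁆

  NoMultiplePoints : Set
  NoMultiplePoints = ∀ x y → x ≢ y → Indep (⁅ x ⁆ ∪ ⁅ y ⁆)

  _∈cl_ : Fin n → Subset n → Set
  x ∈cl S = x ∈ S ⊎′ (∃ λ C → Circuit C × x ∈ C × C ⊆ (S ∪ ⁅ x ⁆))
    where open import Data.Sum using () renaming (_⊎_ to _⊎′_)

  -- S is closed: cl S = S (cl S ⊇ S always holds)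
  Closed : Subset n → Set
  Closed S = ∀ x → x ∈cl S → x ∈ S

  LineClosedSet : Subset n → Set
  LineClosedSet S = ∀ i j → i ∈ S → j ∈ S → ∀ x → x ∈cl (⁅ i ⁆ ∪ ⁅ j ⁆) → x ∈ S

  LineClosed : Set
  LineClosed = ∀ S → LineClosedSet S → Closed S

  _∈lc_ : Fin n → Subset n → Set
  x ∈lc S = ∀ T → LineClosedSet T → S ⊆ T → x ∈ T

  -- A linear ordering of [n] is given by a permutation σ : i ↦ position of i
  module Order (σ : Permutation′ n) where
    _≼_ : Fin n → Fin n → Set
    i ≼ j = (σ ⟨$⟩ʳ i) F.≤ (σ ⟨$⟩ʳ j)

    IsMin : (Fin n → Set) → Fin n → Set
    IsMin P m = P m × (∀ x → P x → m ≼ x)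

    BrokenCircuit : Subset n → Set
    BrokenCircuit B = ∃ λ C → Circuit C × ∃ λ m → IsMin (_∈ C) m × B ≡ C - m

    NBC : Subset n → Set
    NBC S = ∀ B → BrokenCircuit B → ¬ (B ⊆ S)

    _≥in_ : Fin n → Subset n → Fin n → Set
    (i ≥in S) j = j ∈ S × i ≼ j

    _∈lc≥_,_ : Fin n → Fin n → Subset n → Set
    x ∈lc≥ i , S = ∀ T → LineClosedSet T → (∀ j → (i ≥in S) j → j ∈ T) → x ∈ T

    NBB : Subset n → Set
    NBB S = ∀ i → i ∈ S → IsMin (λ x → x ∈lc≥ i , S) i

-- An element x of lc{j ∈ S | i ≼ j} lies in the closure of that set, because closures are
-- line-closed; if x ≺ i, a circuit through x inside the set plus x has minimum x, so S contains
-- a broken circuit.  Hence nbc sets are nbb in every matroid.  If G is line-closed and S is nbb,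
-- a broken circuit C - m ⊆ S (nonempty, as there are no loops) with i = min (C - m) gives
-- m ∈ cl (C - m) ⊆ lc{j ∈ S | i ≼ j}, so i ≼ m ≺ i.  Conversely, if a line-closed S misses some
-- x ∈ cl S, witnessed by a circuit C ⊆ S ∪ {x}, order [n] as: the complement of S, then C - x,
-- then the rest of S.  The broken circuit C - x is then nbb: it is independent, and the
-- line-closures of its tails stay in S.

module Submission where

open import Defs
open import Data.Nat as ℕ using (ℕ; zero; suc; z≤n; s≤s)
import Data.Nat.Properties as ℕₚ
open import Data.Fin as F using (Fin; zero; suc; toℕ; punchIn; inject₁; fromℕ)
import Data.Fin.Properties as Fₚ
open import Data.Fin.Subset using (Subset; Nonempty; _∈_; _∉_; _⊆_; _⊂_; _∪_; _-_; ⁅_⁆; ∣_∣) renaming (⊥ to ∅)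
open import Data.Fin.Subset.Properties
  using ( _∈?_; nonempty?; ⊆-refl; ⊆-trans; x∈p∪q⁻; p⊆p∪q; q⊆p∪q; x∈⁅x⁆; x∈⁅y⁆⇒x≡y; ∉⊥; p─q⊆p
        ; x∈p∧x≢y⇒x∈p-y; x∈p⇒∣p-x∣<∣p∣; x∈p⇒p-x⊂p; p⊂q⇒∣p∣<∣q∣)
open import Data.Fin.Permutation using (Permutation′; _⟨$⟩ʳ_; insert; id)
open import Data.Vec using (_∷_; here; there; tabulate)
open import Data.Vec.Properties using (lookup∘tabulate; []=⇒lookup; lookup⇒[]=)
open import Data.List using (List; []; _∷_; allFin)
open import Data.List.Relation.Unary.Any as Any using ()
open import Data.List.Membership.Propositional using () renaming (_∈_ to _∈ₗ_)
open import Data.List.Membership.Propositional.Properties using (∈-allFin)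
open import Data.Product using (∃; _×_; _,_; proj₁; proj₂)
open import Data.Sum using (_⊎_; inj₁; inj₂; [_,_]′)
open import Data.Empty using (⊥-elim)
open import Data.Bool using (if_then_else_)
open import Function using (_∘_)
open import Function.Bundles using (_⇔_; mk⇔; Injection)
open import Function.Properties.Inverse using (↔⇒↣)
open import Relation.Nullary using (¬_; Dec; yes; no; does; ¬?)
open import Relation.Nullary.Decidable using (dec-true; dec-false; decidable-stable; _×-dec_; _⊎-dec_)
open import Relation.Unary using (Pred; Decidable)
open import Relation.Binary.PropositionalEquality using (_≢_; refl; sym; trans; subst)

x∉p-x : ∀ {n} (p : Subset n) x → x ∉ p - x
x∉p-x (_ ∷ p) zero    ()
x∉p-x (_ ∷ p) (suc x) (there x∈p-x) = x∉p-x p x x∈p-x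

module _ {n : ℕ} where

  x∈p-y⇒x≢y : ∀ (p : Subset n) {x y} → x ∈ p - y → x ≢ y
  x∈p-y⇒x≢y p {x} x∈p-x refl = x∉p-x p x x∈p-x

  ∪-monoˡ : ∀ {p q : Subset n} r → p ⊆ q → p ∪ r ⊆ q ∪ r
  ∪-monoˡ {p} {q} r p⊆q x∈p∪r with x∈p∪q⁻ p r x∈p∪r
  ... | inj₁ x∈p = p⊆p∪q r (p⊆q x∈p)
  ... | inj₂ x∈r = q⊆p∪q q r x∈r

  p⊆q∧x∈q⇒p∪⁅x⁆⊆q : ∀ {p q : Subset n} {x} → p ⊆ q → x ∈ q → p ∪ ⁅ x ⁆ ⊆ q
  p⊆q∧x∈q⇒p∪⁅x⁆⊆q {p} {x = x} p⊆q x∈q y∈p∪x with x∈p∪q⁻ p ⁅ x ⁆ y∈p∪x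
  ... | inj₁ y∈p = p⊆q y∈p
  ... | inj₂ y∈x = subst (_∈ _) (sym (x∈⁅y⁆⇒x≡y x y∈x)) x∈q

  p⊆q∪⁅x⁆⇒p-x⊆q : ∀ {p q : Subset n} {x} → p ⊆ q ∪ ⁅ x ⁆ → p - x ⊆ q
  p⊆q∪⁅x⁆⇒p-x⊆q {p} {q} {x} p⊆q∪x y∈p-x with x∈p∪q⁻ q ⁅ x ⁆ (p⊆q∪x (p─q⊆p p ⁅ x ⁆ y∈p-x))
  ... | inj₁ y∈q = y∈q
  ... | inj₂ y∈x = ⊥-elim (x∈p-y⇒x≢y p y∈p-x (x∈⁅y⁆⇒x≡y x y∈x))

  p-x⊆q⇒p⊆q∪⁅x⁆ : ∀ {p q : Subset n} {x} → p - x ⊆ q → p ⊆ q ∪ ⁅ x ⁆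
  p-x⊆q⇒p⊆q∪⁅x⁆ {q = q} {x} p-x⊆q {y} y∈p with y F.≟ x
  ... | yes refl = q⊆p∪q q ⁅ y ⁆ (x∈⁅x⁆ y)
  ... | no y≢x  = p⊆p∪q ⁅ x ⁆ (p-x⊆q (x∈p∧x≢y⇒x∈p-y y∈p y≢x))

  toSubset : ∀ {p} {P : Pred (Fin n) p} → Decidable P → Subset n
  toSubset P? = tabulate (does ∘ P?)

  module _ {p} {P : Pred (Fin n) p} (P? : Decidable P) where

    ∈-toSubset⁺ : ∀ {x} → P x → x ∈ toSubset P?
    ∈-toSubset⁺ {x} px = lookup⇒[]= x _ (trans (lookup∘tabulate (does ∘ P?) x) (dec-true (P? x) px))

    ∈-toSubset⁻ : ∀ {x} → x ∈ toSubset P? → P x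
    -- The missing `no` clause is refuted by the abstracted equation, which becomes false ≡ true.
    ∈-toSubset⁻ {x} x∈P with P? x | trans (sym (lookup∘tabulate (does ∘ P?) x)) ([]=⇒lookup x∈P)
    ... | yes px | _ = px

  least : ∀ {p} {P : Pred (Fin n) p} (f : Fin n → ℕ) → Decidable P →
          ∀ {x} → P x → ∃ λ m → P m × (∀ y → P y → f m ℕ.≤ f y)
  least {P = P} f P? {x} px = go (suc (f x)) px (ℕₚ.n<1+n (f x))
    where
    go : ∀ k {x} → P x → f x ℕ.< k → ∃ λ m → P m × (∀ y → P y → f m ℕ.≤ f y)
    go (suc k) {x} px fx<1+k with Fₚ.any? (λ y → P? y ×-dec f y ℕₚ.<? f x)
    ... | yes (y , py , fy<fx) = go k py (ℕₚ.<-≤-trans fy<fx (ℕ.s≤s⁻¹ fx<1+k))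
    ... | no ∄smaller = x , px , λ y py → ℕₚ.≮⇒≥ (λ fy<fx → ∄smaller (y , py , fy<fx))

punchIn-< : ∀ {n} (i : Fin (suc n)) (j : Fin n) → toℕ j ℕ.< toℕ i → toℕ (punchIn i j) ℕ.< toℕ i
punchIn-< (suc i) zero    _         = s≤s z≤n
punchIn-< (suc i) (suc j) (s≤s j<i) = s≤s (punchIn-< i j j<i)

punchIn-> : ∀ {n} (i : Fin (suc n)) (j : Fin n) → toℕ i ℕ.≤ toℕ j → toℕ i ℕ.< toℕ (punchIn i j)
punchIn-> zero    j       _         = s≤s z≤n
punchIn-> (suc i) (suc j) (s≤s i≤j) = s≤s (punchIn-> i j i≤j)

punchIn-mono-< : ∀ {n} (i : Fin (suc n)) {j k : Fin n} → j F.< k → punchIn i j F.< punchIn i k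
punchIn-mono-< i {j} {k} j<k = ℕₚ.≰⇒> (ℕₚ.<⇒≱ j<k ∘ Fₚ.punchIn-cancel-≤ i k j)

SortedBy : ∀ {n} → (Fin n → ℕ) → Permutation′ n → Set
SortedBy r σ = ∀ y z → r y ℕ.< r z → σ ⟨$⟩ʳ y F.< σ ⟨$⟩ʳ z

sortedBy-cut : ∀ {n} {r : Fin n → ℕ} {σ} → SortedBy r σ → ∀ c → ∃ λ (p : Fin (suc n)) →
               (∀ y → r y ℕ.≤ c → toℕ (σ ⟨$⟩ʳ y) ℕ.< toℕ p) × (∀ z → c ℕ.< r z → toℕ p ℕ.≤ toℕ (σ ⟨$⟩ʳ z))
sortedBy-cut {n} {r} {σ} sorted c with Fₚ.any? (λ z → c ℕₚ.<? r z)
... | no ∄above = fromℕ n , (λ y _ → subst (toℕ (σ ⟨$⟩ʳ y) ℕ.<_) (sym (Fₚ.toℕ-fromℕ n)) (Fₚ.toℕ<n (σ ⟨$⟩ʳ y)))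
                          , λ z c<rz → ⊥-elim (∄above (z , c<rz))
... | yes (_ , c<rz) with least (λ y → toℕ (σ ⟨$⟩ʳ y)) (λ z → c ℕₚ.<? r z) c<rz
...   | m , c<rm , m-least = inject₁ (σ ⟨$⟩ʳ m) , below , above
  where
  below : ∀ y → r y ℕ.≤ c → toℕ (σ ⟨$⟩ʳ y) ℕ.< toℕ (inject₁ (σ ⟨$⟩ʳ m))
  below y ry≤c =
    subst (toℕ (σ ⟨$⟩ʳ y) ℕ.<_) (sym (Fₚ.toℕ-inject₁ (σ ⟨$⟩ʳ m))) (sorted y m (ℕₚ.≤-<-trans ry≤c c<rm))
  above : ∀ z → c ℕ.< r z → toℕ (inject₁ (σ ⟨$⟩ʳ m)) ℕ.≤ toℕ (σ ⟨$⟩ʳ z)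
  above z c<rz = subst (ℕ._≤ toℕ (σ ⟨$⟩ʳ z)) (sym (Fₚ.toℕ-inject₁ (σ ⟨$⟩ʳ m))) (m-least z c<rz)

sortBy : ∀ {n} (r : Fin n → ℕ) → ∃ (SortedBy r)
sortBy {zero}  r = id , λ ()
sortBy {suc n} r with sortBy (r ∘ suc)
... | σ , sorted with sortedBy-cut {r = r ∘ suc} {σ} sorted (r zero)
...   | p , below , above = insert zero p σ , sorted′
  where
  sorted′ : SortedBy r (insert zero p σ)
  sorted′ zero    zero    r0<r0 = ⊥-elim (ℕₚ.<-irrefl refl r0<r0)
  sorted′ zero    (suc z) r0<rz = punchIn-> p (σ ⟨$⟩ʳ z) (above z r0<rz)
  sorted′ (suc y) zero    ry<r0 = punchIn-< p (σ ⟨$⟩ʳ y) (below y (ℕₚ.<⇒≤ ry<r0))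
  sorted′ (suc y) (suc z) ry<rz = punchIn-mono-< p (sorted y z ry<rz)

layeredOrder : ∀ {n} {A S : Subset n} → A ⊆ S → ∃ λ σ →
               (∀ {x a} → x ∉ S → a ∈ A → σ ⟨$⟩ʳ x F.< σ ⟨$⟩ʳ a) ×
               (∀ {a y} → a ∈ A → y ∈ S → y ∉ A → σ ⟨$⟩ʳ a F.< σ ⟨$⟩ʳ y)
layeredOrder {A = A} {S} A⊆S =
  let σ , sorted = sortBy tier
  in σ , (λ x∉S a∈A → sorted _ _ (outside<A x∉S a∈A)) , λ a∈A y∈S y∉A → sorted _ _ (A<rest a∈A y∈S y∉A)
  where
  tier : Fin _ → ℕ
  tier y = if does (y ∈? S) then (if does (y ∈? A) then 1 else 2) else 0
  outside<A : ∀ {x a} → x ∉ S → a ∈ A → tier x ℕ.< tier a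
  outside<A {x} {a} x∉S a∈A
    rewrite dec-false (x ∈? S) x∉S | dec-true (a ∈? S) (A⊆S a∈A) | dec-true (a ∈? A) a∈A = s≤s z≤n
  A<rest : ∀ {a y} → a ∈ A → y ∈ S → y ∉ A → tier a ℕ.< tier y
  A<rest {a} {y} a∈A y∈S y∉A
    rewrite dec-true (a ∈? S) (A⊆S a∈A) | dec-true (a ∈? A) a∈A | dec-true (y ∈? S) y∈S | dec-false (y ∈? A) y∉A
    = s≤s (s≤s z≤n)

module MatroidClosure {n : ℕ} (G : Matroid n) where
  open Matroid G

  infix 4 _∈ᶜˡ_
  _∈ᶜˡ_ : Fin n → Subset n → Set
  _∈ᶜˡ_ = _∈cl_ G

  dependent⇒⊇circuit : ∀ {D} → ¬ Indep D → ∃ λ C → Circuit G C × C ⊆ D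
  dependent⇒⊇circuit {D} = go (suc ∣ D ∣) D (ℕₚ.n<1+n ∣ D ∣)
    where
    go : ∀ k D → ∣ D ∣ ℕ.< k → ¬ Indep D → ∃ λ C → Circuit G C × C ⊆ D
    go (suc k) D ∣D∣<1+k D-dep with Fₚ.any? (λ d → d ∈? D ×-dec ¬? (Indep-dec (D - d)))
    ... | yes (d , d∈D , D-d-dep) =
      let C , C-circ , C⊆D-d = go k (D - d) (ℕₚ.<-≤-trans (x∈p⇒∣p-x∣<∣p∣ d∈D) (ℕ.s≤s⁻¹ ∣D∣<1+k)) D-d-dep
      in C , C-circ , ⊆-trans C⊆D-d (p─q⊆p D ⁅ d ⁆)
    ... | no ∄removable = D , (D-dep , minimal) , ⊆-refl
      where
      minimal : ∀ E → E ⊂ D → Indep E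
      minimal E (E⊆D , y , y∈D , y∉E) =
        indep-⊆ (λ z∈E → x∈p∧x≢y⇒x∈p-y (E⊆D z∈E) λ { refl → y∉E z∈E })
                (decidable-stable (Indep-dec (D - y)) λ D-y-dep → ∄removable (y , y∈D , D-y-dep))

  ∪⁅x⁆-dependent⇒∈cl : ∀ {I x} → Indep I → ¬ Indep (I ∪ ⁅ x ⁆) → x ∈ᶜˡ I
  ∪⁅x⁆-dependent⇒∈cl {I} {x} I-ind I+x-dep with dependent⇒⊇circuit I+x-dep
  ... | C , C-circ , C⊆I+x with x ∈? C
  ...   | yes x∈C = inj₂ (C , C-circ , x∈C , C⊆I+x)
  ...   | no x∉C  = ⊥-elim (proj₁ C-circ (indep-⊆ C⊆I I-ind))
    where
    C⊆I : C ⊆ I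
    C⊆I c∈C = p⊆q∪⁅x⁆⇒p-x⊆q C⊆I+x (x∈p∧x≢y⇒x∈p-y c∈C λ { refl → x∉C c∈C })

  circuit⇒∈cl : ∀ {C x} → Circuit G C → x ∈ C → x ∈ᶜˡ C - x
  circuit⇒∈cl C-circ x∈C = inj₂ (_ , C-circ , x∈C , p-x⊆q⇒p⊆q∪⁅x⁆ ⊆-refl)

  circuit-x-nonempty : NoLoops G → ∀ {C} → Circuit G C → ∀ x → Nonempty (C - x)
  circuit-x-nonempty no-loops {C} C-circ x =
    decidable-stable (nonempty? (C - x)) λ C-x-empty → proj₁ C-circ (indep-⊆ (C⊆⁅x⁆ C-x-empty) (no-loops x))
    where
    C⊆⁅x⁆ : ¬ Nonempty (C - x) → C ⊆ ⁅ x ⁆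
    C⊆⁅x⁆ C-x-empty {y} y∈C with y F.≟ x
    ... | yes refl = x∈⁅x⁆ y
    ... | no y≢x   = ⊥-elim (C-x-empty (y , x∈p∧x≢y⇒x∈p-y y∈C y≢x))

  cl-mono : ∀ {S T x} → S ⊆ T → x ∈ᶜˡ S → x ∈ᶜˡ T
  cl-mono S⊆T (inj₁ x∈S)                    = inj₁ (S⊆T x∈S)
  cl-mono S⊆T (inj₂ (C , C-circ , x∈C , C⊆S+x)) = inj₂ (C , C-circ , x∈C , ⊆-trans C⊆S+x (∪-monoˡ _ S⊆T))

  Spans : Subset n → Subset n → Set
  Spans I U = ∀ u → u ∈ U → u ∈ I ⊎ ¬ Indep (I ∪ ⁅ u ⁆)

  spans-∪ : ∀ {I T U} → Spans I T → Spans I U → Spans I (T ∪ U)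
  spans-∪ {T = T} {U} I-spans-T I-spans-U u u∈T∪U = [ I-spans-T u , I-spans-U u ]′ (x∈p∪q⁻ T U u∈T∪U)

  extend-spanning : ∀ {K U} → Indep K → K ⊆ U → ∃ λ I → Indep I × K ⊆ I × I ⊆ U × Spans I U
  extend-spanning {U = U} K-ind K⊆U =
    let I , I-ind , K⊆I , I⊆U , I-spans = greedy K-ind K⊆U (allFin n)
    in I , I-ind , K⊆I , I⊆U , λ u u∈U → I-spans u u∈U (∈-allFin u)
    where
    greedy : ∀ {K} → Indep K → K ⊆ U → (l : List (Fin n)) →
             ∃ λ I → Indep I × K ⊆ I × I ⊆ U × (∀ u → u ∈ U → u ∈ₗ l → u ∈ I ⊎ ¬ Indep (I ∪ ⁅ u ⁆))
    greedy K-ind K⊆U [] = _ , K-ind , ⊆-refl , K⊆U , λ _ _ ()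
    greedy {K} K-ind K⊆U (v ∷ l) with v ∈? U ×-dec Indep-dec (K ∪ ⁅ v ⁆)
    ... | yes (v∈U , K+v-ind) =
      let I , I-ind , K+v⊆I , I⊆U , I-spans = greedy K+v-ind (p⊆q∧x∈q⇒p∪⁅x⁆⊆q K⊆U v∈U) l
      in I , I-ind , ⊆-trans (p⊆p∪q ⁅ v ⁆) K+v⊆I , I⊆U ,
         λ { u _ (Any.here refl) → inj₁ (K+v⊆I (q⊆p∪q K ⁅ u ⁆ (x∈⁅x⁆ u)))
           ; u u∈U (Any.there u∈l) → I-spans u u∈U u∈l }
    ... | no ¬addable =
      let I , I-ind , K⊆I , I⊆U , I-spans = greedy K-ind K⊆U l
      in I , I-ind , K⊆I , I⊆U ,
         λ { u u∈U (Any.here refl) → inj₂ λ I+u-ind → ¬addable (u∈U , indep-⊆ (∪-monoˡ ⁅ u ⁆ K⊆I) I+u-ind)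
           ; u u∈U (Any.there u∈l) → I-spans u u∈U u∈l }

  spans⇒∣indep∣≤ : ∀ {I U K} → Indep I → Spans I U → Indep K → K ⊆ U → ∣ K ∣ ℕ.≤ ∣ I ∣
  spans⇒∣indep∣≤ I-ind I-spans K-ind K⊆U = ℕₚ.≮⇒≥ λ ∣I∣<∣K∣ →
    let y , y∈K , y∉I , I+y-ind = exchange I-ind K-ind ∣I∣<∣K∣
    in [ y∉I , (λ I+y-dep → I+y-dep I+y-ind) ]′ (I-spans y (K⊆U y∈K))

  spans-cl : ∀ {I T x} → Indep I → Spans I T → x ∈ᶜˡ T → x ∈ I ⊎ ¬ Indep (I ∪ ⁅ x ⁆)
  spans-cl I-ind I-spans (inj₁ x∈T) = I-spans _ x∈T
  -- Extend C - x to K spanning I ∪ T; as C ⊆ K ∪ ⁅ x ⁆, K also spans x, so ∣ I ∪ ⁅ x ⁆ ∣ ≤ ∣ K ∣ ≤ ∣ I ∣.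
  spans-cl {I} {T} {x} I-ind I-spans (inj₂ (C , C-circ , x∈C , C⊆T+x)) with x ∈? I | Indep-dec (I ∪ ⁅ x ⁆)
  ... | yes x∈I | _          = inj₁ x∈I
  ... | no _    | no I+x-dep = inj₂ I+x-dep
  ... | no x∉I  | yes I+x-ind with extend-spanning (proj₂ C-circ (C - x) (x∈p⇒p-x⊂p x∈C))
                                     (⊆-trans (p⊆q∪⁅x⁆⇒p-x⊆q C⊆T+x) (q⊆p∪q I T))
  ...   | K , K-ind , C-x⊆K , K⊆I∪T , K-spans = ⊥-elim (ℕₚ.<⇒≱ ∣I∣<∣I+x∣ (ℕₚ.≤-trans ∣I+x∣≤∣K∣ ∣K∣≤∣I∣))
    where
    ∣I∣<∣I+x∣ : ∣ I ∣ ℕ.< ∣ I ∪ ⁅ x ⁆ ∣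
    ∣I∣<∣I+x∣ = p⊂q⇒∣p∣<∣q∣ (p⊆p∪q ⁅ x ⁆ , x , q⊆p∪q I ⁅ x ⁆ (x∈⁅x⁆ x) , x∉I)
    ∣K∣≤∣I∣ : ∣ K ∣ ℕ.≤ ∣ I ∣
    ∣K∣≤∣I∣ = spans⇒∣indep∣≤ I-ind (spans-∪ (λ _ → inj₁) I-spans) K-ind K⊆I∪T
    K-spans-x : Spans K ⁅ x ⁆
    K-spans-x u u∈x rewrite x∈⁅y⁆⇒x≡y x u∈x =
      inj₂ λ K+x-ind → proj₁ C-circ (indep-⊆ (p-x⊆q⇒p⊆q∪⁅x⁆ C-x⊆K) K+x-ind)
    ∣I+x∣≤∣K∣ : ∣ I ∪ ⁅ x ⁆ ∣ ℕ.≤ ∣ K ∣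
    ∣I+x∣≤∣K∣ = spans⇒∣indep∣≤ K-ind (spans-∪ K-spans K-spans-x) I+x-ind (∪-monoˡ ⁅ x ⁆ (p⊆p∪q T))

  basis : ∀ T → ∃ λ I → Indep I × I ⊆ T × Spans I T
  basis T = let I , I-ind , _ , I⊆T , I-spans = extend-spanning indep-∅ (⊥-elim ∘ ∉⊥)
            in I , I-ind , I⊆T , I-spans

  spanned⇒∈cl : ∀ {I T x} → Indep I → I ⊆ T → x ∈ I ⊎ ¬ Indep (I ∪ ⁅ x ⁆) → x ∈ᶜˡ T
  spanned⇒∈cl I-ind I⊆T = [ inj₁ ∘ I⊆T , cl-mono I⊆T ∘ ∪⁅x⁆-dependent⇒∈cl I-ind ]′

  cl-trans : ∀ {X T x} → (∀ y → y ∈ X → y ∈ᶜˡ T) → x ∈ᶜˡ X → x ∈ᶜˡ T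
  cl-trans {T = T} X⊆clT x∈clX =
    let I , I-ind , I⊆T , I-spans = basis T
    in spanned⇒∈cl I-ind I⊆T (spans-cl I-ind (λ y → spans-cl I-ind I-spans ∘ X⊆clT y) x∈clX)

  _∈cl?_ : ∀ x T → Dec (x ∈ᶜˡ T)
  x ∈cl? T with basis T
  ... | I , I-ind , I⊆T , I-spans with x ∈? I ⊎-dec ¬? (Indep-dec (I ∪ ⁅ x ⁆))
  ...   | yes spanned = yes (spanned⇒∈cl I-ind I⊆T spanned)
  ...   | no ¬spanned = no (¬spanned ∘ spans-cl I-ind I-spans)

  closure : Subset n → Subset n
  closure T = toSubset (_∈cl? T)

  closure-lineClosed : ∀ T → LineClosedSet G (closure T)
  closure-lineClosed T i j i∈clT j∈clT x x∈cl-ij = ∈-toSubset⁺ (_∈cl? T) (cl-trans ij⊆clT x∈cl-ij)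
    where
    ij⊆clT : ∀ y → y ∈ ⁅ i ⁆ ∪ ⁅ j ⁆ → y ∈ᶜˡ T
    ij⊆clT y y∈ij with x∈p∪q⁻ ⁅ i ⁆ ⁅ j ⁆ y∈ij
    ... | inj₁ y∈i rewrite x∈⁅y⁆⇒x≡y i y∈i = ∈-toSubset⁻ (_∈cl? T) i∈clT
    ... | inj₂ y∈j rewrite x∈⁅y⁆⇒x≡y j y∈j = ∈-toSubset⁻ (_∈cl? T) j∈clT

  ∈lineClosure⇒∈cl : ∀ {p} {P : Pred (Fin n) p} (P? : Decidable P) {x} →
                     (∀ T → LineClosedSet G T → (∀ j → P j → j ∈ T) → x ∈ T) → x ∈ᶜˡ toSubset P?
  ∈lineClosure⇒∈cl P? x∈lc =
    ∈-toSubset⁻ (_∈cl? _) (x∈lc _ (closure-lineClosed _) λ _ Pj → ∈-toSubset⁺ (_∈cl? _) (inj₁ (∈-toSubset⁺ P? Pj)))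

module BrokenCircuits {n : ℕ} (G : Matroid n) (σ : Permutation′ n) where
  open Matroid G
  open Order G σ
  open MatroidClosure G

  _≼?_ : ∀ i j → Dec (i ≼ j)
  i ≼? j = σ ⟨$⟩ʳ i Fₚ.≤? σ ⟨$⟩ʳ j

  minimum : ∀ {P : Fin n → Set} → Decidable P → ∀ {x} → P x → ∃ (IsMin P)
  minimum = least (toℕ ∘ (σ ⟨$⟩ʳ_))

  ≥in? : ∀ i S → Decidable (i ≥in S)
  ≥in? i S j = j ∈? S ×-dec i ≼? j

  ∈lc≥-refl : ∀ {i S} → i ∈ S → i ∈lc≥ i , S
  ∈lc≥-refl i∈S _ _ ≥i⊆T = ≥i⊆T _ (i∈S , Fₚ.≤-refl)

  ≺-lc≥⇒circuit : ∀ {i S x} → x ∈lc≥ i , S → ¬ i ≼ x →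
                  ∃ λ C → Circuit G C × IsMin (_∈ C) x × C ⊆ S ∪ ⁅ x ⁆
  ≺-lc≥⇒circuit {i} {S} {x} x∈lc i⋠x with ∈lineClosure⇒∈cl (≥in? i S) x∈lc
  ... | inj₁ x≥i = ⊥-elim (i⋠x (proj₂ (∈-toSubset⁻ (≥in? i S) x≥i)))
  ... | inj₂ (C , C-circ , x∈C , C⊆≥i+x) =
    C , C-circ , (x∈C , x≼C) , ⊆-trans C⊆≥i+x (∪-monoˡ ⁅ x ⁆ (proj₁ ∘ ∈-toSubset⁻ (≥in? i S)))
    where
    x≼C : ∀ y → y ∈ C → x ≼ y
    x≼C y y∈C with x∈p∪q⁻ _ ⁅ x ⁆ (C⊆≥i+x y∈C)
    ... | inj₁ y≥i = ℕₚ.≤-trans (ℕₚ.<⇒≤ (ℕₚ.≰⇒> i⋠x)) (proj₂ (∈-toSubset⁻ (≥in? i S) y≥i))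
    ... | inj₂ y∈x rewrite x∈⁅y⁆⇒x≡y x y∈x = Fₚ.≤-refl

  nbc⇒nbb : ∀ {S} → NBC S → NBB S
  nbc⇒nbb {S} nbc i i∈S = ∈lc≥-refl i∈S , i≼lc
    where
    i≼lc : ∀ x → x ∈lc≥ i , S → i ≼ x
    i≼lc x x∈lc = decidable-stable (i ≼? x) λ i⋠x →
      let C , C-circ , x-min , C⊆S+x = ≺-lc≥⇒circuit x∈lc i⋠x
      in nbc (C - x) (C , C-circ , x , x-min , refl) (p⊆q∪⁅x⁆⇒p-x⊆q C⊆S+x)

  nbb⇒nbc : NoLoops G → LineClosed G → ∀ {S} → NBB S → NBC S
  nbb⇒nbc no-loops line-closed {S} nbb _ (C , C-circ , m , (m∈C , m≼C) , refl) C-m⊆S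
    with minimum (_∈? (C - m)) (proj₂ (circuit-x-nonempty no-loops C-circ m))
  ... | i , i∈C-m , i≼C-m =
    x∈p-y⇒x≢y C i∈C-m (Injection.injective (↔⇒↣ σ) (Fₚ.≤-antisym i≼m (m≼C i (p─q⊆p C ⁅ m ⁆ i∈C-m))))
    where
    m∈lc : m ∈lc≥ i , S
    m∈lc T T-lc ≥i⊆T =
      line-closed T T-lc m (cl-mono (λ c∈C-m → ≥i⊆T _ (C-m⊆S c∈C-m , i≼C-m _ c∈C-m)) (circuit⇒∈cl C-circ m∈C))
    i≼m : i ≼ m
    i≼m = proj₂ (nbb i (C-m⊆S i∈C-m)) m m∈lc

  independent⇒nbb : ∀ {A S} → Indep A → LineClosedSet G S → A ⊆ S →
                    (∀ {a y} → a ∈ A → y ∈ S → y ∉ A → a ≼ y) → NBB A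
  independent⇒nbb {A} {S} A-ind S-lc A⊆S A≼S-A a a∈A = ∈lc≥-refl a∈A , a≼lc
    where
    a≼lc : ∀ y → y ∈lc≥ a , A → a ≼ y
    a≼lc y y∈lc with y ∈? A
    ... | no y∉A  = A≼S-A a∈A (y∈lc S S-lc λ _ j≥a → A⊆S (proj₁ j≥a)) y∉A
    ... | yes y∈A = decidable-stable (a ≼? y) λ a⋠y →
      let C , C-circ , _ , C⊆A+y = ≺-lc≥⇒circuit y∈lc a⋠y
      in proj₁ C-circ (indep-⊆ (⊆-trans C⊆A+y (p⊆q∧x∈q⇒p∪⁅x⁆⊆q ⊆-refl y∈A)) A-ind)

nbb⇒nbc⇒lineClosed : ∀ {n} (G : Matroid n) → (∀ σ S → Order.NBB G σ S → Order.NBC G σ S) → LineClosed G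
nbb⇒nbc⇒lineClosed G nbb⇒nbc S S-lc x (inj₁ x∈S) = x∈S
nbb⇒nbc⇒lineClosed G nbb⇒nbc S S-lc x (inj₂ (C , C-circ , x∈C , C⊆S+x))
  with x ∈? S | layeredOrder (p⊆q∪⁅x⁆⇒p-x⊆q C⊆S+x)
... | yes x∈S | _ = x∈S
... | no x∉S  | σ , outside≺C-x , C-x≺rest =
  ⊥-elim (nbb⇒nbc σ (C - x) C-x-nbb (C - x) (C , C-circ , x , (x∈C , x≼C) , refl) ⊆-refl)
  where
  open Order G σ using (_≼_)
  x≼C : ∀ y → y ∈ C → x ≼ y
  x≼C y y∈C with y F.≟ x
  ... | yes refl = Fₚ.≤-refl
  ... | no y≢x   = ℕₚ.<⇒≤ (outside≺C-x x∉S (x∈p∧x≢y⇒x∈p-y y∈C y≢x))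
  C-x-nbb : Order.NBB G σ (C - x)
  C-x-nbb = BrokenCircuits.independent⇒nbb G σ (proj₂ C-circ (C - x) (x∈p⇒p-x⊂p x∈C)) S-lc
              (p⊆q∪⁅x⁆⇒p-x⊆q C⊆S+x) λ a∈C-x y∈S y∉C-x → ℕₚ.<⇒≤ (C-x≺rest a∈C-x y∈S y∉C-x)

theorem2p13 : ∀ {n : ℕ} (G : Matroid n) → NoLoops G → NoMultiplePoints G →
    (LineClosed G ⇔ (∀ (σ : Permutation′ n) (S : Subset n) →
      (Order.NBB G σ S → Order.NBC G σ S) × (Order.NBC G σ S → Order.NBB G σ S)))
theorem2p13 G no-loops _ = mk⇔
  (λ line-closed σ S → nbb⇒nbc σ no-loops line-closed , nbc⇒nbb σ)
  (λ nbb⇔nbc → nbb⇒nbc⇒lineClosed G λ σ S → proj₁ (nbb⇔nbc σ S))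
  where open BrokenCircuits G
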